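{- Let $n\ge4$ be even, $p=n/2$, and $z\in\rho_n(D^{n-2}_1)$. Then $s_{j-1}\notin\tau_{\mathbf m}(\nu_j(z))$ for all $2\le j\le k_z-1$, and $k_z\le p+1$.
   Context: $S_n$ symmetric group, $s_i=(i,i+1)$, $S=\{s_1,\dots,s_{n-1}\}$, $\ell$ length, $\mathcal F_m$ fixed-point-free involutions in $S_m$, Bruhat order the weakest partial order with $z\le tzt$ for transpositions $t$ with $\ell(z)\le\ell(tzt)$; $\tau_{\mathbf m}(z)=\{s\in S:szs\le z\}$. View $S_{n-2}\subset S_n$ fixing $n-1,n$; $w_0$ longest element of $S_n$; $\rho_n(z)=w_0zs_{n-1}w_0$; $\sigma_j=s_j\cdots s_1$; $Y_1=\rho_n(\mathcal F_{n-2})$; $\nu_j(x)=\sigma_jx\sigma_j^{ -1}$ for $x\in Y_1$ ($\nu_1=\mathrm{id}$). For $z\in Y_1$, $k_z$ is the unique integer $k$ with $3\le k\le n-1$ such that $s_1\nu_k(z)s_1=\nu_{k-1}(z)$ (equivalently $k_z=z(3)-1$). The sets $D^m_1\subseteq\mathcal F_m$ are defined recursively by $D^2_1=\{s_1\}$ and $D^m_1=\{\nu_j(z): z\in\rho_m(D^{m-2}_1),\ 1\le j<k_z\}$ for $m\ge4$. -}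

module Defs where

open import Data.Nat using (ℕ; zero; suc; _+_; _∸_; _≤_; _<_; _≡ᵇ_; _<ᵇ_)
open import Data.Bool using (if_then_else_)
open import Data.List using (List; []; _∷_; map; upTo; concatMap)
open import Data.Nat.ListAction using (sum)
open import Relation.Binary.Construct.Closure.ReflexiveTransitive using (Star)

-- Permutations of {1,…,n} in one-line notation: w = [w(1), …, w(n)].
Perm : Set
Perm = List ℕ

ids : ℕ → List ℕ
ids n = map suc (upTo n)

-- w(i) (1-indexed); points beyond the list are fixed.  This realises the
-- embedding S_{m} ⊂ S_n (fixing m+1, …, n).
app′ : ℕ → Perm → ℕ → ℕ
app′ i [] k = i
app′ i (x ∷ w) zero = x
app′ i (x ∷ w) (suc k) = app′ i w k

app : Perm → ℕ → ℕ
app w zero = zero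
app w (suc k) = app′ (suc k) w k

comp : ℕ → Perm → Perm → Perm
comp n u v = map (λ i → app u (app v i)) (ids n)

idP : ℕ → Perm
idP n = ids n

pre : ℕ → Perm → ℕ → ℕ
pre k [] i = zero
pre k (x ∷ w) i = if x ≡ᵇ i then k else pre (suc k) w i

invP : ℕ → Perm → Perm
invP n w = map (λ i → pre 1 w i) (ids n)

tr : ℕ → ℕ → ℕ → Perm
tr n i j = map (λ k → if k ≡ᵇ i then j else (if k ≡ᵇ j then i else k)) (ids n)

s : ℕ → ℕ → Perm
s n i = tr n i (suc i)

-- Coxeter length = number of inversions
ℓ : Perm → ℕ
ℓ [] = zero
ℓ (x ∷ w) = sum (map (λ y → if y <ᵇ x then 1 else 0) w) + ℓ w

-- conjugation t z t⁻¹ (used with t an involution: t z t)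
conj : ℕ → Perm → Perm → Perm
conj n t z = comp n t (comp n z (invP n t))

-- one generating relation of the Bruhat order: z ≤ t z t for a transposition
-- t of S_n with ℓ(z) ≤ ℓ(t z t)
data BStep (n : ℕ) : Perm → Perm → Set where
  bstep : ∀ {i j z} → 1 ≤ i → i < j → j ≤ n →
          ℓ z ≤ ℓ (conj n (tr n i j) z) →
          BStep n z (conj n (tr n i j) z)

BruhatLe : ℕ → Perm → Perm → Set
BruhatLe n = Star (BStep n)

-- s_i ∈ τ_m(z)  :⇔  s_i z s_i ≤ z   (s_i ∈ S, i.e. 1 ≤ i ≤ n-1)
InTau : ℕ → ℕ → Perm → Set
InTau n i z = (1 ≤ i) Data.Product.× (suc i ≤ n) Data.Product.× BruhatLe n (conj n (s n i) z) z
  where import Data.Product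

w0 : ℕ → Perm
w0 n = map (λ i → suc n ∸ i) (ids n)

ρ : ℕ → Perm → Perm
ρ n z = comp n (w0 n) (comp n z (comp n (s n (n ∸ 1)) (w0 n)))

σ : ℕ → ℕ → Perm
σ n zero = idP n
σ n (suc j) = comp n (s n (suc j)) (σ n j)

ν : ℕ → ℕ → Perm → Perm
ν n j x = comp n (σ n j) (comp n x (invP n (σ n j)))

kz : Perm → ℕ
kz z = app z 3 ∸ 1

-- D^m_1 (as a list; only even m ≥ 2 are meaningful)
D : ℕ → List Perm
D zero = []
D (suc zero) = []
D (suc (suc zero)) = s 2 1 ∷ []
D (suc (suc (suc m))) =
  concatMap (λ z → map (λ j → ν (3 + m) j z) (ids (kz z ∸ 1)))
            (map (ρ (3 + m)) (D (suc m)))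

{-# OPTIONS --safe #-}

-- Every element of D^m_1 is a fixed-point-free involution of {1, …, m} without nested arcs
-- (no a < b < z b < z a): ρ preserves this and adds the arc (1 2), and ν_j with j < k_z
-- preserves it. For such a z with z 1 = 2, each point strictly between 3 and z 3 opens an
-- arc that may not nest inside (3, z 3), so z is increasing on [3, z 3); this gives
-- n ≥ z (z 3 - 1) ≥ 2 z 3 - 4, i.e. k_z ≤ p + 1, and it makes ν_j(z) ascend from position
-- j - 1 to j. Conjugating a fixed-point-free involution by s_i at an ascent strictly
-- increases the number of inversions, while every Bruhat step weakly increases it.

module Submission where

open import Defs
open import Data.Nat using (ℕ; zero; suc; _+_; _*_; _∸_; _≤_; _<_; _≮_; z≤n; s≤s; z<s; s<s; _≡ᵇ_; _<ᵇ_; _≟_; _≤?_)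
open import Data.Nat.Properties
open import Algebra.Properties.CommutativeSemigroup +-commutativeSemigroup using (x∙yz≈y∙xz)
open import Data.Nat.ListAction using (sum)
open import Data.Bool using (true; false; if_then_else_)
open import Data.Bool.Properties using (T-≡)
open import Data.List using (List; []; _∷_; map; applyUpTo)
open import Data.List.Properties using (map-applyUpTo; map-upTo)
open import Data.List.Relation.Unary.All using (All; []; _∷_)
open import Data.List.Relation.Unary.AllPairs using (AllPairs; []; _∷_)
import Data.List.Relation.Unary.AllPairs.Properties as AllPairs
open import Data.List.Membership.Propositional using (_∈_; find)
open import Data.List.Membership.Propositional.Properties using (∈-map⁻; ∈-upTo⁻; ∈-concatMap⁻)
open import Data.List.Relation.Unary.Any using (here)
open import Data.Product using (_×_; _,_; proj₁; proj₂)
open import Data.Sum using (_⊎_; inj₁; inj₂; [_,_]′)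
open import Data.Empty using (⊥; ⊥-elim)
open import Function using (_∘_)
open import Function.Bundles using (Equivalence)
open import Relation.Nullary using (¬_; yes; no)
open import Relation.Binary.Definitions using (tri<; tri≈; tri>)
open import Relation.Binary.PropositionalEquality
open ≡-Reasoning
open import Relation.Binary.Construct.Closure.ReflexiveTransitive using (ε; _◅_)
open import Data.Nat.Tactic.RingSolver using (solve-∀)

≡ᵇ-true : ∀ {x y} → x ≡ y → (x ≡ᵇ y) ≡ true
≡ᵇ-true {x} {y} x≡y = Equivalence.to T-≡ (≡⇒≡ᵇ x y x≡y)

≡ᵇ-false : ∀ {x y} → x ≢ y → (x ≡ᵇ y) ≡ false
≡ᵇ-false {x} {y} x≢y with x ≡ᵇ y in eq
... | true  = ⊥-elim (x≢y (≡ᵇ⇒≡ x y (Equivalence.from T-≡ eq)))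
... | false = refl

<ᵇ-true : ∀ {x y} → x < y → (x <ᵇ y) ≡ true
<ᵇ-true x<y = Equivalence.to T-≡ (<⇒<ᵇ x<y)

<ᵇ-false : ∀ {x y} → x ≮ y → (x <ᵇ y) ≡ false
<ᵇ-false {x} {y} x≮y with x <ᵇ y in eq
... | true  = ⊥-elim (x≮y (<ᵇ⇒< x y (Equivalence.from T-≡ eq)))
... | false = refl

-- Evaluating permutations in one-line notation

applyUpTo-cong : ∀ {g h : ℕ → ℕ} n → (∀ {k} → k < n → g k ≡ h k) → applyUpTo g n ≡ applyUpTo h n
applyUpTo-cong zero    g≗h = refl
applyUpTo-cong (suc n) g≗h = cong₂ _∷_ (g≗h z<s) (applyUpTo-cong n (g≗h ∘ s<s))

map-ids : ∀ (f : ℕ → ℕ) n → map f (ids n) ≡ applyUpTo (f ∘ suc) n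
map-ids f n = trans (cong (map f) (map-upTo suc n)) (map-applyUpTo suc f n)

app′-applyUpTo-< : ∀ d (g : ℕ → ℕ) {n k} → k < n → app′ d (applyUpTo g n) k ≡ g k
app′-applyUpTo-< d g {suc n} {zero}  _         = refl
app′-applyUpTo-< d g {suc n} {suc k} (s<s k<n) = app′-applyUpTo-< d (g ∘ suc) k<n

app′-applyUpTo-≥ : ∀ d (g : ℕ → ℕ) {n k} → n ≤ k → app′ d (applyUpTo g n) k ≡ d
app′-applyUpTo-≥ d g {zero}          _         = refl
app′-applyUpTo-≥ d g {suc n} {suc k} (s≤s n≤k) = app′-applyUpTo-≥ d (g ∘ suc) n≤k

app-map-ids : ∀ f {n i} → 1 ≤ i → i ≤ n → app (map f (ids n)) i ≡ f i
app-map-ids f {n} {suc k} _ k<n =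
  trans (cong (λ w → app′ (suc k) w k) (map-ids f n)) (app′-applyUpTo-< (suc k) (f ∘ suc) k<n)

app-map-ids-> : ∀ f {n i} → n < i → app (map f (ids n)) i ≡ i
app-map-ids-> f {n} {suc k} (s≤s n≤k) =
  trans (cong (λ w → app′ (suc k) w k) (map-ids f n)) (app′-applyUpTo-≥ (suc k) (f ∘ suc) n≤k)

app-ids : ∀ {n i} → 1 ≤ i → i ≤ n → app (ids n) i ≡ i
app-ids {n} {suc k} _ k<n =
  trans (cong (λ w → app′ (suc k) w k) (map-upTo suc n)) (app′-applyUpTo-< (suc k) suc k<n)

app-comp : ∀ {n u v i} → 1 ≤ i → i ≤ n → app (comp n u v) i ≡ app u (app v i)
app-comp {u = u} {v} = app-map-ids (λ i → app u (app v i))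

pre-applyUpTo : ∀ c (g : ℕ → ℕ) {n v t} → t < n → g t ≡ v → (∀ {u} → u < t → g u ≢ v) →
                pre c (applyUpTo g n) v ≡ c + t
pre-applyUpTo c g {suc n} {t = zero} _ gt≡v _ rewrite ≡ᵇ-true gt≡v = sym (+-identityʳ c)
pre-applyUpTo c g {suc n} {t = suc t} (s<s t<n) gt≡v earlier rewrite ≡ᵇ-false (earlier z<s) =
  trans (pre-applyUpTo (suc c) (g ∘ suc) t<n gt≡v (earlier ∘ s<s)) (sym (+-suc c t))

app-invP : ∀ {n} (f g : ℕ → ℕ) → (∀ {k} → 1 ≤ k → k ≤ n → 1 ≤ g k × g k ≤ n) →
           (∀ {k} → 1 ≤ k → k ≤ n → f (g k) ≡ k) → (∀ {k} → 1 ≤ k → k ≤ n → g (f k) ≡ k) →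
           ∀ {i} → 1 ≤ i → i ≤ n → app (invP n (map f (ids n))) i ≡ g i
app-invP {n} f g g-range f∘g g∘f {i} 1≤i i≤n with g i in gi≡ | g-range 1≤i i≤n
... | suc t | _ , t<n = begin
  app (invP n (map f (ids n))) i      ≡⟨ app-map-ids (λ v → pre 1 (map f (ids n)) v) 1≤i i≤n ⟩
  pre 1 (map f (ids n)) i             ≡⟨ cong (λ w → pre 1 w i) (map-ids f n) ⟩
  pre 1 (applyUpTo (f ∘ suc) n) i     ≡⟨ pre-applyUpTo 1 (f ∘ suc) t<n f[1+t]≡i earlier ⟩
  suc t                               ∎
  where
  f[1+t]≡i : f (suc t) ≡ i
  f[1+t]≡i = subst (λ k → f k ≡ i) gi≡ (f∘g 1≤i i≤n)
  earlier : ∀ {u} → u < t → f (suc u) ≢ i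
  earlier u<t f[1+u]≡i = <-irrefl (suc-injective (trans (sym (g∘f z<s 1+u≤n)) (trans (cong g f[1+u]≡i) gi≡))) u<t
    where 1+u≤n = ≤-trans (s≤s (<⇒≤ u<t)) t<n

app-w0 : ∀ {n k} → 1 ≤ k → k ≤ n → app (w0 n) k ≡ suc n ∸ k
app-w0 {n} = app-map-ids (λ i → suc n ∸ i)

-- The simple reflections and σ_j as functions

-- Written exactly as in the definition of tr, so that s n i is definitionally map (sᶠ i) (ids n).
sᶠ : ℕ → ℕ → ℕ
sᶠ i k = if k ≡ᵇ i then suc i else (if k ≡ᵇ suc i then i else k)

sᶠ-left : ∀ i → sᶠ i i ≡ suc i
sᶠ-left i rewrite ≡ᵇ-true (refl {x = i}) = refl

sᶠ-right : ∀ i → sᶠ i (suc i) ≡ i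
sᶠ-right i rewrite ≡ᵇ-false (>⇒≢ (n<1+n i)) | ≡ᵇ-true (refl {x = suc i}) = refl

sᶠ-other : ∀ {i k} → k ≢ i → k ≢ suc i → sᶠ i k ≡ k
sᶠ-other k≢i k≢1+i rewrite ≡ᵇ-false k≢i | ≡ᵇ-false k≢1+i = refl

sᶠ-involutive : ∀ i k → sᶠ i (sᶠ i k) ≡ k
sᶠ-involutive i k with k ≟ i | k ≟ suc i
... | yes refl | _        rewrite sᶠ-left k = sᶠ-right k
... | no _     | yes refl rewrite sᶠ-right i = sᶠ-left i
... | no k≢i   | no k≢1+i rewrite sᶠ-other k≢i k≢1+i = sᶠ-other k≢i k≢1+i

sᶠ-range : ∀ {n i k} → 1 ≤ i → suc i ≤ n → 1 ≤ k → k ≤ n → 1 ≤ sᶠ i k × sᶠ i k ≤ n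
sᶠ-range {n} {i} {k} 1≤i i<n 1≤k k≤n with k ≟ i | k ≟ suc i
... | yes refl | _        rewrite sᶠ-left k = s≤s z≤n , i<n
... | no _     | yes refl rewrite sᶠ-right i = 1≤i , <⇒≤ i<n
... | no k≢i   | no k≢1+i rewrite sᶠ-other k≢i k≢1+i = 1≤k , k≤n

sᶠ-suc : ∀ t u → sᶠ (suc t) (suc u) ≡ suc (sᶠ t u)
sᶠ-suc t u with u ≡ᵇ t | u ≡ᵇ suc t
... | true  | _     = refl
... | false | true  = refl
... | false | false = refl

sᶠ-<-preserving : ∀ {i x y} → y < x → ¬ (x ≡ suc i × y ≡ i) → sᶠ i y < sᶠ i x
sᶠ-<-preserving {i} {x} {y} y<x ¬x,y≡1+i,i with x ≟ i | x ≟ suc i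
... | yes refl | _ rewrite sᶠ-left x | sᶠ-other (<⇒≢ y<x) (<⇒≢ (m<n⇒m<1+n y<x)) = m<n⇒m<1+n y<x
... | no _ | yes refl = subst₂ _<_ (sym (sᶠ-other y≢i (<⇒≢ y<x))) (sym (sᶠ-right i)) (≤∧≢⇒< (≤-pred y<x) y≢i)
  where y≢i = λ y≡i → ¬x,y≡1+i,i (refl , y≡i)
... | no x≢i | no x≢1+i rewrite sᶠ-other x≢i x≢1+i with y ≟ i | y ≟ suc i
...   | yes refl | _        rewrite sᶠ-left y = ≤∧≢⇒< y<x (≢-sym x≢1+i)
...   | no _     | yes refl rewrite sᶠ-right i = <-trans (n<1+n i) y<x
...   | no y≢i   | no y≢1+i rewrite sᶠ-other y≢i y≢1+i = y<x

app-s : ∀ {n i} → 1 ≤ i → suc i ≤ n → ∀ k → app (s n i) k ≡ sᶠ i k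
app-s {i = suc i} _ _ zero = refl
app-s {n} {i} 1≤i i<n (suc k) with suc k ≤? n
... | yes k<n = app-map-ids (sᶠ i) (s≤s z≤n) k<n
... | no k≮n  = trans (app-map-ids-> (sᶠ i) n<1+k)
                      (sym (sᶠ-other (>⇒≢ (<-trans i<n n<1+k)) (>⇒≢ (≤-<-trans i<n n<1+k))))
  where n<1+k = ≰⇒> k≮n

app-invP-s : ∀ {n i k} → 1 ≤ i → suc i ≤ n → 1 ≤ k → k ≤ n → app (invP n (s n i)) k ≡ sᶠ i k
app-invP-s {i = i} 1≤i i<n =
  app-invP (sᶠ i) (sᶠ i) (sᶠ-range 1≤i i<n) (λ _ _ → sᶠ-involutive i _) (λ _ _ → sᶠ-involutive i _)

σᶠ : ℕ → ℕ → ℕ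
σᶠ zero    k = k
σᶠ (suc j) k = sᶠ (suc j) (σᶠ j k)

σ⁻¹ᶠ : ℕ → ℕ → ℕ
σ⁻¹ᶠ zero    k = k
σ⁻¹ᶠ (suc j) k = σ⁻¹ᶠ j (sᶠ (suc j) k)

σᶠ-σ⁻¹ᶠ : ∀ j k → σᶠ j (σ⁻¹ᶠ j k) ≡ k
σᶠ-σ⁻¹ᶠ zero    k = refl
σᶠ-σ⁻¹ᶠ (suc j) k = trans (cong (sᶠ (suc j)) (σᶠ-σ⁻¹ᶠ j _)) (sᶠ-involutive (suc j) k)

σ⁻¹ᶠ-σᶠ : ∀ j k → σ⁻¹ᶠ j (σᶠ j k) ≡ k
σ⁻¹ᶠ-σᶠ zero    k = refl
σ⁻¹ᶠ-σᶠ (suc j) k = trans (cong (σ⁻¹ᶠ j) (sᶠ-involutive (suc j) (σᶠ j k))) (σ⁻¹ᶠ-σᶠ j k)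

σᶠ-range : ∀ {n} j {k} → suc j ≤ n → 1 ≤ k → k ≤ n → 1 ≤ σᶠ j k × σᶠ j k ≤ n
σᶠ-range zero    _     1≤k k≤n = 1≤k , k≤n
σᶠ-range (suc j) j+1<n 1≤k k≤n =
  let 1≤σk , σk≤n = σᶠ-range j (<⇒≤ j+1<n) 1≤k k≤n in sᶠ-range (s≤s z≤n) j+1<n 1≤σk σk≤n

σ⁻¹ᶠ-range : ∀ {n} j {k} → suc j ≤ n → 1 ≤ k → k ≤ n → 1 ≤ σ⁻¹ᶠ j k × σ⁻¹ᶠ j k ≤ n
σ⁻¹ᶠ-range zero    _     1≤k k≤n = 1≤k , k≤n
σ⁻¹ᶠ-range (suc j) j+1<n 1≤k k≤n =
  let 1≤sk , sk≤n = sᶠ-range (s≤s z≤n) j+1<n 1≤k k≤n in σ⁻¹ᶠ-range j (<⇒≤ j+1<n) 1≤sk sk≤n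

σᶠ-> : ∀ {j k} → suc j < k → σᶠ j k ≡ k
σᶠ-> {zero}  _     = refl
σᶠ-> {suc j} j+1<k rewrite σᶠ-> (<-trans (n<1+n _) j+1<k) =
  sᶠ-other (>⇒≢ (<-trans (n<1+n _) j+1<k)) (>⇒≢ j+1<k)

σ⁻¹ᶠ-> : ∀ {j k} → suc j < k → σ⁻¹ᶠ j k ≡ k
σ⁻¹ᶠ-> {zero}  _     = refl
σ⁻¹ᶠ-> {suc j} j+1<k rewrite sᶠ-other (>⇒≢ (<-trans (n<1+n _) j+1<k)) (>⇒≢ j+1<k) =
  σ⁻¹ᶠ-> (<-trans (n<1+n _) j+1<k)

σ⁻¹ᶠ-top : ∀ j → σ⁻¹ᶠ j (suc j) ≡ 1
σ⁻¹ᶠ-top zero    = refl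
σ⁻¹ᶠ-top (suc j) rewrite sᶠ-right (suc j) = σ⁻¹ᶠ-top j

σ⁻¹ᶠ-≤ : ∀ {j k} → 1 ≤ k → k ≤ j → σ⁻¹ᶠ j k ≡ suc k
σ⁻¹ᶠ-≤ {zero} 1≤k k≤0 = ⊥-elim (<⇒≱ 1≤k k≤0)
σ⁻¹ᶠ-≤ {suc j} {k} 1≤k k≤1+j with m≤n⇒m<n∨m≡n k≤1+j
... | inj₂ refl rewrite sᶠ-left k = σ⁻¹ᶠ-> (n<1+n k)
... | inj₁ k≤j rewrite sᶠ-other (<⇒≢ k≤j) (<⇒≢ (m<n⇒m<1+n k≤j)) = σ⁻¹ᶠ-≤ 1≤k (≤-pred k≤j)

σᶠ-1 : ∀ j → σᶠ j 1 ≡ suc j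
σᶠ-1 j = trans (cong (σᶠ j) (sym (σ⁻¹ᶠ-top j))) (σᶠ-σ⁻¹ᶠ j (suc j))

σᶠ-suc : ∀ {j k} → 1 ≤ k → k ≤ j → σᶠ j (suc k) ≡ k
σᶠ-suc {j} {k} 1≤k k≤j = trans (cong (σᶠ j) (sym (σ⁻¹ᶠ-≤ 1≤k k≤j))) (σᶠ-σ⁻¹ᶠ j k)

σ⁻¹ᶠ-piece : ∀ j {k} → 1 ≤ k → k ≢ suc j → (k ≤ j × σ⁻¹ᶠ j k ≡ suc k) ⊎ (suc j < k × σ⁻¹ᶠ j k ≡ k)
σ⁻¹ᶠ-piece j {k} 1≤k k≢1+j with <-cmp k (suc j)
... | tri< k≤j _ _ = inj₁ (≤-pred k≤j , σ⁻¹ᶠ-≤ 1≤k (≤-pred k≤j))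
... | tri≈ _ k≡1+j _ = ⊥-elim (k≢1+j k≡1+j)
... | tri> _ _ 1+j<k = inj₂ (1+j<k , σ⁻¹ᶠ-> 1+j<k)

σ⁻¹ᶠ-<-preserving : ∀ j {x y} → 1 ≤ x → x < y → x ≢ suc j → y ≢ suc j → σ⁻¹ᶠ j x < σ⁻¹ᶠ j y
σ⁻¹ᶠ-<-preserving j 1≤x x<y x≢1+j y≢1+j
  with σ⁻¹ᶠ-piece j 1≤x x≢1+j | σ⁻¹ᶠ-piece j (≤-trans 1≤x (<⇒≤ x<y)) y≢1+j
... | inj₁ (_ , σx≡) | inj₁ (_ , σy≡) rewrite σx≡ | σy≡ = s<s x<y
... | inj₁ (x≤j , σx≡) | inj₂ (j+1<y , σy≡) rewrite σx≡ | σy≡ = ≤-<-trans (s≤s x≤j) j+1<y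
... | inj₂ (j+1<x , _) | inj₁ (y≤j , _) = ⊥-elim (<-asym (<-trans x<y (s≤s y≤j)) j+1<x)
... | inj₂ (_ , σx≡) | inj₂ (_ , σy≡) rewrite σx≡ | σy≡ = x<y

app-σ : ∀ {n} j {k} → suc j ≤ n → 1 ≤ k → k ≤ n → app (σ n j) k ≡ σᶠ j k
app-σ zero _ 1≤k k≤n = app-ids 1≤k k≤n
app-σ {n} (suc j) {k} j+1<n 1≤k k≤n = begin
  app (σ n (suc j)) k                ≡⟨ app-comp 1≤k k≤n ⟩
  app (s n (suc j)) (app (σ n j) k)  ≡⟨ app-s (s≤s z≤n) j+1<n (app (σ n j) k) ⟩
  sᶠ (suc j) (app (σ n j) k)         ≡⟨ cong (sᶠ (suc j)) (app-σ j (<⇒≤ j+1<n) 1≤k k≤n) ⟩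
  σᶠ (suc j) k                       ∎

app-invP-σ : ∀ {n} j {k} → suc (suc j) ≤ n → 1 ≤ k → k ≤ n → app (invP n (σ n (suc j))) k ≡ σ⁻¹ᶠ (suc j) k
app-invP-σ {n} j j+1<n =
  app-invP f (σ⁻¹ᶠ (suc j)) (σ⁻¹ᶠ-range (suc j) j+1<n)
    (λ {k} 1≤k k≤n → let 1≤σ⁻¹k , σ⁻¹k≤n = σ⁻¹ᶠ-range (suc j) j+1<n 1≤k k≤n in
                     trans (f≗σᶠ 1≤σ⁻¹k σ⁻¹k≤n) (σᶠ-σ⁻¹ᶠ (suc j) k))
    (λ {k} 1≤k k≤n → trans (cong (σ⁻¹ᶠ (suc j)) (f≗σᶠ 1≤k k≤n)) (σ⁻¹ᶠ-σᶠ (suc j) k))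
  where
  f : ℕ → ℕ
  f i = app (s n (suc j)) (app (σ n j) i)
  f≗σᶠ : ∀ {k} → 1 ≤ k → k ≤ n → f k ≡ σᶠ (suc j) k
  f≗σᶠ 1≤k k≤n = trans (sym (app-comp 1≤k k≤n)) (app-σ (suc j) j+1<n 1≤k k≤n)

-- Nonnesting fixed-point-free involutions

record IsFPFInvolution (m : ℕ) (f : ℕ → ℕ) : Set where
  field
    lower          : ∀ i → 1 ≤ i → i ≤ m → 1 ≤ f i
    upper          : ∀ i → 1 ≤ i → i ≤ m → f i ≤ m
    involutive     : ∀ i → 1 ≤ i → i ≤ m → f (f i) ≡ i
    fixedPointFree : ∀ i → 1 ≤ i → i ≤ m → f i ≢ i

record IsNonnestingInvolution (m : ℕ) (f : ℕ → ℕ) : Set where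
  field
    isFPFInvolution : IsFPFInvolution m f
    nonnesting      : ∀ a b → 1 ≤ a → a < b → b ≤ m → b < f b → f b < f a → ⊥

  open IsFPFInvolution isFPFInvolution public

IsFPFInvolution-cong : ∀ {m f g} → (∀ i → 1 ≤ i → i ≤ m → g i ≡ f i) →
                       IsFPFInvolution m f → IsFPFInvolution m g
IsFPFInvolution-cong {m} {f} {g} g≗f F = record
  { lower          = λ i 1≤i i≤m → subst (1 ≤_) (sym (g≗f i 1≤i i≤m)) (lower i 1≤i i≤m)
  ; upper          = λ i 1≤i i≤m → subst (_≤ m) (sym (g≗f i 1≤i i≤m)) (upper i 1≤i i≤m)
  ; involutive     = λ i 1≤i i≤m → begin
      g (g i)  ≡⟨ cong g (g≗f i 1≤i i≤m) ⟩
      g (f i)  ≡⟨ g≗f (f i) (lower i 1≤i i≤m) (upper i 1≤i i≤m) ⟩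
      f (f i)  ≡⟨ involutive i 1≤i i≤m ⟩
      i        ∎
  ; fixedPointFree = λ i 1≤i i≤m gi≡i → fixedPointFree i 1≤i i≤m (trans (sym (g≗f i 1≤i i≤m)) gi≡i)
  }
  where open IsFPFInvolution F

IsNonnestingInvolution-cong : ∀ {m f g} → (∀ i → 1 ≤ i → i ≤ m → g i ≡ f i) →
                              IsNonnestingInvolution m f → IsNonnestingInvolution m g
IsNonnestingInvolution-cong {m} {f} {g} g≗f F = record
  { isFPFInvolution = IsFPFInvolution-cong g≗f isFPFInvolution
  ; nonnesting      = λ a b 1≤a a<b b≤m b<gb gb<ga →
      let 1≤b = ≤-trans 1≤a (<⇒≤ a<b) ; a≤m = ≤-trans (<⇒≤ a<b) b≤m in
      nonnesting a b 1≤a a<b b≤m (subst (b <_) (g≗f b 1≤b b≤m) b<gb)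
                 (subst₂ _<_ (g≗f b 1≤b b≤m) (g≗f a 1≤a a≤m) gb<ga)
  }
  where open IsNonnestingInvolution F

nonnesting-0 : ∀ f → IsNonnestingInvolution 0 f
nonnesting-0 f = record
  { isFPFInvolution = record
    { lower = λ _ 1≤i i≤0 → ⊥-elim (<⇒≱ 1≤i i≤0)
    ; upper = λ _ 1≤i i≤0 → ⊥-elim (<⇒≱ 1≤i i≤0)
    ; involutive = λ _ 1≤i i≤0 → ⊥-elim (<⇒≱ 1≤i i≤0)
    ; fixedPointFree = λ _ 1≤i i≤0 → ⊥-elim (<⇒≱ 1≤i i≤0)
    }
  ; nonnesting = λ _ _ _ a<b b≤0 _ _ → <⇒≱ (≤-<-trans z≤n a<b) b≤0
  }

FixesAbove : ℕ → Perm → Set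
FixesAbove m x = ∀ i → m < i → app x i ≡ i

comp-fixesAbove : ∀ n u v → FixesAbove n (comp n u v)
comp-fixesAbove n u v i = app-map-ids-> (λ i → app u (app v i))

NonnestingPerm : ℕ → Perm → Set
NonnestingPerm m x = IsNonnestingInvolution m (app x) × FixesAbove m x

-- The maps ρ and ν_j

reflect : ℕ → ℕ → ℕ
reflect m y = suc m ∸ y

reflect-≥1 : ∀ {m y} → y ≤ m → 1 ≤ reflect m y
reflect-≥1 y≤m rewrite +-∸-assoc 1 y≤m = s≤s z≤n

reflect-≤ : ∀ {m y} → 1 ≤ y → reflect m y ≤ m
reflect-≤ {m} {suc y} _ = m∸n≤m m y

reflect-involutive : ∀ {m y} → y ≤ suc m → reflect m (reflect m y) ≡ y
reflect-involutive = m∸[m∸n]≡n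

reflect-<-reversing : ∀ {m x y} → x < y → y ≤ suc m → reflect m y < reflect m x
reflect-<-reversing = ∸-monoʳ-<

reflected : ℕ → (ℕ → ℕ) → ℕ → ℕ
reflected m X y = reflect m (X (reflect m y))

module _ {m X} (X-nn : IsNonnestingInvolution m X) where
  open IsNonnestingInvolution X-nn

  private
    R = reflect m
    X∘R-range : ∀ y → 1 ≤ y → y ≤ m → 1 ≤ X (R y) × X (R y) ≤ m
    X∘R-range y 1≤y y≤m = lower (R y) (reflect-≥1 y≤m) (reflect-≤ 1≤y) ,
                          upper (R y) (reflect-≥1 y≤m) (reflect-≤ 1≤y)
    RRX≡X : ∀ y → 1 ≤ y → y ≤ m → R (R (X y)) ≡ X y
    RRX≡X y 1≤y y≤m = reflect-involutive (m≤n⇒m≤1+n (upper y 1≤y y≤m))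

  reflected-isFPFInvolution : IsFPFInvolution m (reflected m X)
  reflected-isFPFInvolution = record
    { lower          = λ y 1≤y y≤m → reflect-≥1 (proj₂ (X∘R-range y 1≤y y≤m))
    ; upper          = λ y 1≤y y≤m → reflect-≤ (proj₁ (X∘R-range y 1≤y y≤m))
    ; involutive     = λ y 1≤y y≤m → let 1≤Ry = reflect-≥1 y≤m ; Ry≤m = reflect-≤ 1≤y in begin
        R (X (R (R (X (R y)))))  ≡⟨ cong (R ∘ X) (RRX≡X (R y) 1≤Ry Ry≤m) ⟩
        R (X (X (R y)))          ≡⟨ cong R (involutive (R y) 1≤Ry Ry≤m) ⟩
        R (R y)                  ≡⟨ reflect-involutive (m≤n⇒m≤1+n y≤m) ⟩
        y                        ∎
    ; fixedPointFree = λ y 1≤y y≤m RXRy≡y →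
        fixedPointFree (R y) (reflect-≥1 y≤m) (reflect-≤ 1≤y)
          (trans (sym (RRX≡X (R y) (reflect-≥1 y≤m) (reflect-≤ 1≤y))) (cong R RXRy≡y))
    }

  -- Reflection reverses the order, so a nesting a < b < Y b < Y a of Y = R X R
  -- is a nesting X(R a) < X(R b) < R b < R a of X.
  reflected-nonnesting : IsNonnestingInvolution m (reflected m X)
  reflected-nonnesting = record
    { isFPFInvolution = reflected-isFPFInvolution
    ; nonnesting      = λ a b 1≤a a<b b≤m b<Yb Yb<Ya →
      let a≤m = ≤-trans (<⇒≤ a<b) b≤m
          1≤Ra , Ra≤m = reflect-≥1 a≤m , reflect-≤ 1≤a
          1≤Rb , Rb≤m = reflect-≥1 b≤m , reflect-≤ (≤-trans 1≤a (<⇒≤ a<b))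
          1≤XRb , XRb≤m = X∘R-range b (≤-trans 1≤a (<⇒≤ a<b)) b≤m
          1≤XRa , _ = X∘R-range a 1≤a a≤m
          XRb<Rb = subst (_< R b) (RRX≡X (R b) 1≤Rb Rb≤m)
                     (reflect-<-reversing b<Yb (m≤n⇒m≤1+n (reflect-≤ 1≤XRb)))
          XRa<XRb = subst₂ _<_ (RRX≡X (R a) 1≤Ra Ra≤m) (RRX≡X (R b) 1≤Rb Rb≤m)
                      (reflect-<-reversing Yb<Ya (m≤n⇒m≤1+n (reflect-≤ 1≤XRa)))
      in nonnesting (X (R a)) (X (R b)) (lower (R a) 1≤Ra Ra≤m) XRa<XRb XRb≤m
           (subst (X (R b) <_) (sym (involutive (R b) 1≤Rb Rb≤m)) XRb<Rb)
           (subst₂ _<_ (sym (involutive (R b) 1≤Rb Rb≤m)) (sym (involutive (R a) 1≤Ra Ra≤m))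
              (reflect-<-reversing a<b (m≤n⇒m≤1+n b≤m)))
    }

-- On {1, …, m + 2}, ρ_{m+2}(x) consists of the arc (1 2) and the arcs of x reflected by
-- y ↦ m + 1 - y and shifted by 2.
prependArc12 : (ℕ → ℕ) → ℕ → ℕ
prependArc12 Y zero                = zero
prependArc12 Y (suc zero)          = 2
prependArc12 Y (suc (suc zero))    = 1
prependArc12 Y (suc (suc (suc k))) = 2 + Y (suc k)

prependArc12-shift : ∀ Y {y} → 1 ≤ y → prependArc12 Y (2 + y) ≡ 2 + Y y
prependArc12-shift Y {suc y} _ = refl

prependArc12-nonnesting : ∀ {m Y} → IsNonnestingInvolution m Y → IsNonnestingInvolution (2 + m) (prependArc12 Y)
prependArc12-nonnesting {m} {Y} Y-nn = record
  { isFPFInvolution = record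
    { lower = lower′ ; upper = upper′ ; involutive = involutive′ ; fixedPointFree = fixedPointFree′ }
  ; nonnesting = nonnesting′
  }
  where
  open IsNonnestingInvolution Y-nn
  Z = prependArc12 Y

  lower′ : ∀ i → 1 ≤ i → i ≤ 2 + m → 1 ≤ Z i
  lower′ 1                   _ _ = s≤s z≤n
  lower′ 2                   _ _ = s≤s z≤n
  lower′ (suc (suc (suc k))) _ _ = s≤s z≤n

  upper′ : ∀ i → 1 ≤ i → i ≤ 2 + m → Z i ≤ 2 + m
  upper′ 1                   _ _                 = s≤s (s≤s z≤n)
  upper′ 2                   _ _                 = s≤s z≤n
  upper′ (suc (suc (suc k))) _ (s≤s (s≤s k<m)) = s≤s (s≤s (upper (suc k) (s≤s z≤n) k<m))

  involutive′ : ∀ i → 1 ≤ i → i ≤ 2 + m → Z (Z i) ≡ i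
  involutive′ 1                   _ _                 = refl
  involutive′ 2                   _ _                 = refl
  involutive′ (suc (suc (suc k))) _ (s≤s (s≤s k<m)) =
    trans (prependArc12-shift Y (lower (suc k) (s≤s z≤n) k<m)) (cong (2 +_) (involutive (suc k) (s≤s z≤n) k<m))

  fixedPointFree′ : ∀ i → 1 ≤ i → i ≤ 2 + m → Z i ≢ i
  fixedPointFree′ 1                   _ _                 ()
  fixedPointFree′ 2                   _ _                 ()
  fixedPointFree′ (suc (suc (suc k))) _ (s≤s (s≤s k<m)) eq =
    fixedPointFree (suc k) (s≤s z≤n) k<m (suc-injective (suc-injective eq))

  nonnesting′ : ∀ a b → 1 ≤ a → a < b → b ≤ 2 + m → b < Z b → Z b < Z a → ⊥
  nonnesting′ 1 b _ 1<b _ b<Zb Zb<2 = <⇒≱ (<-trans b<Zb Zb<2) 1<b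
  nonnesting′ 2 b _ 2<b _ b<Zb Zb<1 = <⇒≱ (<-trans b<Zb Zb<1) (≤-trans (s≤s z≤n) 2<b)
  nonnesting′ (suc (suc (suc a))) (suc (suc (suc b))) _ (s≤s (s≤s a<b)) (s≤s (s≤s b<m))
              (s≤s (s≤s b<Zb)) (s≤s (s≤s Zb<Za)) =
    nonnesting (suc a) (suc b) (s≤s z≤n) a<b b<m b<Zb Zb<Za

ρᶠ : ℕ → (ℕ → ℕ) → ℕ → ℕ
ρᶠ m X = prependArc12 (reflected m X)

app-ρ : ∀ {m x} → IsFPFInvolution m (app x) → FixesAbove m x →
        ∀ i → 1 ≤ i → i ≤ 2 + m → app (ρ (2 + m) x) i ≡ ρᶠ m (app x) i
app-ρ {m} {x} X-inv x-fixes i 1≤i i≤n = begin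
  app (ρ n x) i                                   ≡⟨ app-comp 1≤i i≤n ⟩
  app (w0 n) (app (comp n x (comp n S (w0 n))) i) ≡⟨ cong (app (w0 n)) (app-comp 1≤i i≤n) ⟩
  app (w0 n) (app x (app (comp n S (w0 n)) i))    ≡⟨ cong (λ k → app (w0 n) (app x k)) S∘w0 ⟩
  app (w0 n) (app x (sᶠ (suc m) (suc n ∸ i)))     ≡⟨ by-cases i 1≤i i≤n ⟩
  ρᶠ m (app x) i                                  ∎
  where
  open IsFPFInvolution X-inv
  n = 2 + m
  S = s n (suc m)
  S∘w0 : app (comp n S (w0 n)) i ≡ sᶠ (suc m) (suc n ∸ i)
  S∘w0 = trans (app-comp 1≤i i≤n)
           (trans (app-s {n} (s≤s z≤n) ≤-refl (app (w0 n) i)) (cong (sᶠ (suc m)) (app-w0 1≤i i≤n)))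
  by-cases : ∀ i → 1 ≤ i → i ≤ n → app (w0 n) (app x (sᶠ (suc m) (suc n ∸ i))) ≡ ρᶠ m (app x) i
  by-cases 1 _ _
    rewrite sᶠ-right (suc m) | x-fixes (suc m) ≤-refl | app-w0 {n} (s≤s z≤n) (n≤1+n _) = m+n∸n≡m 2 m
  by-cases 2 _ _
    rewrite sᶠ-left (suc m) | x-fixes (suc (suc m)) (n≤1+n _) | app-w0 {n} (s≤s z≤n) (≤-refl {n}) =
      m+n∸n≡m 1 (suc m)
  by-cases (suc (suc (suc k))) _ (s≤s (s≤s k<m)) =
    let 1≤y , y≤m = reflect-≥1 k<m , reflect-≤ {m} (s≤s (z≤n {k}))
        1≤xy , xy≤m = lower (m ∸ k) 1≤y y≤m , upper (m ∸ k) 1≤y y≤m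
    in begin
      app (w0 n) (app x (sᶠ (suc m) (m ∸ k)))
        ≡⟨ cong (app (w0 n) ∘ app x) (sᶠ-other (<⇒≢ (s≤s y≤m)) (<⇒≢ (s≤s (m≤n⇒m≤1+n y≤m)))) ⟩
      app (w0 n) (app x (m ∸ k))              ≡⟨ app-w0 1≤xy (m≤n⇒m≤1+n (m≤n⇒m≤1+n xy≤m)) ⟩
      suc n ∸ app x (m ∸ k)                   ≡⟨ +-∸-assoc 2 (m≤n⇒m≤1+n xy≤m) ⟩
      2 + reflect m (app x (m ∸ k))           ∎

ρ-nonnesting : ∀ {m x} → NonnestingPerm m x → NonnestingPerm (2 + m) (ρ (2 + m) x)
ρ-nonnesting {m} {x} (x-nn , x-fixes) =
  IsNonnestingInvolution-cong (app-ρ isFPFInvolution x-fixes) (prependArc12-nonnesting (reflected-nonnesting x-nn)) ,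
  comp-fixesAbove _ _ _
  where open IsNonnestingInvolution x-nn

ρ-1 : ∀ {m x} → NonnestingPerm m x → app (ρ (2 + m) x) 1 ≡ 2
ρ-1 (x-nn , x-fixes) = app-ρ (IsNonnestingInvolution.isFPFInvolution x-nn) x-fixes 1 (s≤s z≤n) (s≤s z≤n)

νᶠ : ℕ → (ℕ → ℕ) → ℕ → ℕ
νᶠ j Z i = σᶠ j (Z (σ⁻¹ᶠ j i))

app-ν : ∀ {n} j {z} → suc (suc j) ≤ n → IsFPFInvolution n (app z) →
        ∀ i → 1 ≤ i → i ≤ n → app (ν n (suc j) z) i ≡ νᶠ (suc j) (app z) i
app-ν {n} j {z} j+1<n Z-inv i 1≤i i≤n =
  let 1≤τi , τi≤n = σ⁻¹ᶠ-range (suc j) j+1<n 1≤i i≤n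
      τ = σ⁻¹ᶠ (suc j)
  in begin
  app (ν n (suc j) z) i
    ≡⟨ app-comp 1≤i i≤n ⟩
  app (σ n (suc j)) (app (comp n z (invP n (σ n (suc j)))) i)
    ≡⟨ cong (app (σ n (suc j))) (app-comp 1≤i i≤n) ⟩
  app (σ n (suc j)) (app z (app (invP n (σ n (suc j))) i))
    ≡⟨ cong (app (σ n (suc j)) ∘ app z) (app-invP-σ j j+1<n 1≤i i≤n) ⟩
  app (σ n (suc j)) (app z (τ i))
    ≡⟨ app-σ (suc j) j+1<n (lower (τ i) 1≤τi τi≤n) (upper (τ i) 1≤τi τi≤n) ⟩
  νᶠ (suc j) (app z) i
    ∎
  where open IsFPFInvolution Z-inv

νᶠ-isFPFInvolution : ∀ {n j Z} → suc j ≤ n → IsFPFInvolution n Z → IsFPFInvolution n (νᶠ j Z)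
νᶠ-isFPFInvolution {n} {j} {Z} j<n Z-inv = record
  { lower          = λ i 1≤i i≤n → proj₁ (νᶠ-range i 1≤i i≤n)
  ; upper          = λ i 1≤i i≤n → proj₂ (νᶠ-range i 1≤i i≤n)
  ; involutive     = λ i 1≤i i≤n → let 1≤τi , τi≤n = σ⁻¹ᶠ-range j j<n 1≤i i≤n in begin
      σᶠ j (Z (σ⁻¹ᶠ j (σᶠ j (Z (τ i))))) ≡⟨ cong (σᶠ j ∘ Z) (σ⁻¹ᶠ-σᶠ j (Z (τ i))) ⟩
      σᶠ j (Z (Z (τ i)))                 ≡⟨ cong (σᶠ j) (involutive (τ i) 1≤τi τi≤n) ⟩
      σᶠ j (τ i)                         ≡⟨ σᶠ-σ⁻¹ᶠ j i ⟩
      i                                  ∎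
  ; fixedPointFree = λ i 1≤i i≤n Yi≡i → let 1≤τi , τi≤n = σ⁻¹ᶠ-range j j<n 1≤i i≤n in
      fixedPointFree (τ i) 1≤τi τi≤n (trans (sym (σ⁻¹ᶠ-σᶠ j (Z (τ i)))) (cong τ Yi≡i))
  }
  where
  open IsFPFInvolution Z-inv
  τ = σ⁻¹ᶠ j
  νᶠ-range : ∀ i → 1 ≤ i → i ≤ n → 1 ≤ νᶠ j Z i × νᶠ j Z i ≤ n
  νᶠ-range i 1≤i i≤n = let 1≤τi , τi≤n = σ⁻¹ᶠ-range j j<n 1≤i i≤n in
    σᶠ-range j j<n (lower (τ i) 1≤τi τi≤n) (upper (τ i) 1≤τi τi≤n)

≢1,2,3⇒3< : ∀ {c} → 1 ≤ c → c ≢ 1 → c ≢ 2 → c ≢ 3 → 3 < c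
≢1,2,3⇒3< {1}                   _ c≢1 _   _   = ⊥-elim (c≢1 refl)
≢1,2,3⇒3< {2}                   _ _   c≢2 _   = ⊥-elim (c≢2 refl)
≢1,2,3⇒3< {3}                   _ _   _   c≢3 = ⊥-elim (c≢3 refl)
≢1,2,3⇒3< {suc (suc (suc (suc c)))} _ _ _ _   = s≤s (s≤s (s≤s (s≤s z≤n)))

module WithArc12 {n Z} (Z-nn : IsNonnestingInvolution n Z) (Z1≡2 : Z 1 ≡ 2) (3≤n : 3 ≤ n) where
  open IsNonnestingInvolution Z-nn

  Z2≡1 : Z 2 ≡ 1
  Z2≡1 = trans (cong Z (sym Z1≡2)) (involutive 1 (s≤s z≤n) (≤-trans (s≤s z≤n) 3≤n))

  Z3≤n : Z 3 ≤ n
  Z3≤n = upper 3 (s≤s z≤n) 3≤n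

  private
    Z-injective : ∀ {a b} → 1 ≤ a → a ≤ n → 1 ≤ b → b ≤ n → Z a ≡ Z b → a ≡ b
    Z-injective {a} {b} 1≤a a≤n 1≤b b≤n Za≡Zb =
      trans (sym (involutive a 1≤a a≤n)) (trans (cong Z Za≡Zb) (involutive b 1≤b b≤n))

  3<Z3 : 3 < Z 3
  3<Z3 = ≢1,2,3⇒3< (lower 3 1≤3 3≤n)
           (λ Z3≡1 → 3≢2 (Z-injective 1≤3 3≤n (s≤s z≤n) 2≤n (trans Z3≡1 (sym Z2≡1))))
           (λ Z3≡2 → 3≢1 (Z-injective 1≤3 3≤n (s≤s z≤n) (≤-trans (s≤s z≤n) 3≤n) (trans Z3≡2 (sym Z1≡2))))
           (fixedPointFree 3 1≤3 3≤n)
    where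
    1≤3 = s≤s z≤n
    2≤n = ≤-trans (s≤s (s≤s z≤n)) 3≤n
    3≢2 : 3 ≢ 2
    3≢2 ()
    3≢1 : 3 ≢ 1
    3≢1 ()

  -- Otherwise the arc (Z i, i) would nest inside (3, Z 3).
  opens-inside-arc-3 : ∀ i → 3 < i → i < Z 3 → i < Z i
  opens-inside-arc-3 i 3<i i<Z3 = ≤∧≢⇒< (≮⇒≥ nested) (fixedPointFree i 1≤i i≤n ∘ sym)
    where
    1≤i = ≤-trans (s≤s z≤n) (<⇒≤ 3<i)
    i≤n = ≤-trans (<⇒≤ i<Z3) Z3≤n
    ZZi≡i = involutive i 1≤i i≤n
    3<Zi : 3 < Z i
    3<Zi = ≢1,2,3⇒3< (lower i 1≤i i≤n)
             (λ Zi≡1 → <⇒≢ (<-trans (s≤s (s≤s (s≤s z≤n))) 3<i) (sym (trans (sym ZZi≡i) (trans (cong Z Zi≡1) Z1≡2))))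
             (λ Zi≡2 → <⇒≢ (<-trans (s≤s (s≤s z≤n)) 3<i) (sym (trans (sym ZZi≡i) (trans (cong Z Zi≡2) Z2≡1))))
             (λ Zi≡3 → <⇒≢ i<Z3 (trans (sym ZZi≡i) (cong Z Zi≡3)))
    nested : Z i ≮ i
    nested Zi<i = nonnesting 3 (Z i) (s≤s z≤n) 3<Zi (upper i 1≤i i≤n)
                    (subst (Z i <_) (sym ZZi≡i) Zi<i) (subst (_< Z 3) (sym ZZi≡i) i<Z3)

  Z3≤Z : ∀ i → 3 ≤ i → i < Z 3 → Z 3 ≤ Z i
  Z3≤Z i 3≤i i<Z3 with m≤n⇒m<n∨m≡n 3≤i
  ... | inj₂ refl = ≤-refl
  ... | inj₁ 3<i  = ≮⇒≥ (nonnesting 3 i (s≤s z≤n) 3<i (≤-trans (<⇒≤ i<Z3) Z3≤n) (opens-inside-arc-3 i 3<i i<Z3))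

  Z-increasing : ∀ i → 3 ≤ i → suc i < Z 3 → Z i < Z (suc i)
  Z-increasing i 3≤i 1+i<Z3 =
    ≤∧≢⇒< (≮⇒≥ (nonnesting i (suc i) 1≤i (n<1+n i) 1+i≤n 1+i<Z[1+i]))
          (<⇒≢ (n<1+n i) ∘ Z-injective 1≤i (≤-trans (n≤1+n i) 1+i≤n) (s≤s z≤n) 1+i≤n)
    where
    1≤i = ≤-trans (s≤s z≤n) 3≤i
    1+i≤n = ≤-trans (<⇒≤ 1+i<Z3) Z3≤n
    1+i<Z[1+i] = opens-inside-arc-3 (suc i) (s≤s 3≤i) 1+i<Z3

  Z3+t≤Z : ∀ t → 3 + t < Z 3 → Z 3 + t ≤ Z (3 + t)
  Z3+t≤Z zero    _      = ≤-reflexive (+-identityʳ (Z 3))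
  Z3+t≤Z (suc t) 4+t<Z3 = subst (_≤ Z (4 + t)) (sym (+-suc (Z 3) t))
    (≤-<-trans (Z3+t≤Z t (<-trans (n<1+n _) 4+t<Z3)) (Z-increasing (3 + t) (m≤m+n 3 t) 4+t<Z3))

  -- Z is increasing on [3, Z 3), so n ≥ Z (Z 3 - 1) ≥ 2 Z 3 - 4.
  arc-3-bound : 2 * (Z 3 ∸ 1) ≤ n + 2
  arc-3-bound = let t , 4+t≡Z3 = m≤n⇒∃[o]m+o≡n 3<Z3 in
    subst (λ c → c + t + 2 ≤ n + 2 → 2 * (c ∸ 1) ≤ n + 2) 4+t≡Z3
      (subst (_≤ n + 2) (arith t))
      (+-monoˡ-≤ 2 (Z3+t≤n t 4+t≡Z3))
    where
    arith : ∀ t → 4 + t + t + 2 ≡ 2 * (3 + t)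
    arith = solve-∀
    Z3+t≤n : ∀ t → 4 + t ≡ Z 3 → Z 3 + t ≤ n
    Z3+t≤n t 4+t≡Z3 = let 3+t<Z3 = ≤-reflexive 4+t≡Z3 in
      ≤-trans (Z3+t≤Z t 3+t<Z3) (upper (3 + t) (s≤s z≤n) (≤-trans (<⇒≤ 3+t<Z3) Z3≤n))

  Z3∸1≤p+1 : ∀ {p} → n ≡ 2 * p → Z 3 ∸ 1 ≤ p + 1
  Z3∸1≤p+1 {p} n≡2p =
    *-cancelˡ-≤ 2 (subst (2 * (Z 3 ∸ 1) ≤_) (trans (cong (_+ 2) n≡2p) (sym (*-distribˡ-+ 2 p 1))) arc-3-bound)

  νᶠ-ascent : ∀ t → 4 + t ≤ Z 3 → νᶠ (2 + t) Z (suc t) < νᶠ (2 + t) Z (2 + t)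
  νᶠ-ascent t 4+t≤Z3 =
    subst₂ _<_ (sym (νᶠ-at (suc t) (s≤s z≤n) (n≤1+n _))) (sym (νᶠ-at (2 + t) (s≤s z≤n) ≤-refl)) (ascent t 4+t≤Z3)
    where
    νᶠ-at : ∀ i → 1 ≤ i → i ≤ 2 + t → νᶠ (2 + t) Z i ≡ σᶠ (2 + t) (Z (suc i))
    νᶠ-at i 1≤i i≤j = cong (σᶠ (2 + t) ∘ Z) (σ⁻¹ᶠ-≤ 1≤i i≤j)
    ascent : ∀ t → 4 + t ≤ Z 3 → σᶠ (2 + t) (Z (2 + t)) < σᶠ (2 + t) (Z (3 + t))
    ascent zero    4≤Z3 rewrite Z2≡1 | σᶠ-> {2} 4≤Z3 = 4≤Z3
    ascent (suc t) 5+t≤Z3 rewrite σᶠ-> (<-≤-trans 5+t≤Z3 (Z3≤Z (3 + t) (m≤m+n 3 t) (<-trans (n<1+n _) 5+t≤Z3)))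
                                | σᶠ-> (<-≤-trans 5+t≤Z3 (Z3≤Z (4 + t) (m≤m+n 3 (suc t)) 5+t≤Z3))
      = Z-increasing (3 + t) (m≤m+n 3 t) 5+t≤Z3

  module _ {j} (1≤j : 1 ≤ j) (2+j≤Z3 : 2 + j ≤ Z 3) where
    private
      j<n : suc j ≤ n
      j<n = ≤-trans (n≤1+n _) (≤-trans 2+j≤Z3 Z3≤n)
      Y = νᶠ j Z
      τ = σ⁻¹ᶠ j
      τ∘Y : ∀ i → τ (Y i) ≡ Z (τ i)
      τ∘Y i = σ⁻¹ᶠ-σᶠ j (Z (τ i))
      Y-inv = νᶠ-isFPFInvolution j<n isFPFInvolution
      open IsFPFInvolution Y-inv renaming (lower to Y-lower; involutive to Y-involutive)

    νᶠ-1 : Y 1 ≡ suc j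
    νᶠ-1 = trans (cong (σᶠ j ∘ Z) (σ⁻¹ᶠ-≤ ≤-refl 1≤j)) (trans (cong (σᶠ j) Z2≡1) (σᶠ-1 j))

    νᶠ-1+j : Y (suc j) ≡ 1
    νᶠ-1+j = trans (cong (σᶠ j ∘ Z) (σ⁻¹ᶠ-top j)) (trans (cong (σᶠ j) Z1≡2) (σᶠ-suc ≤-refl 1≤j))

    shifted-arc : ∀ b → 1 < b → b < Y b → Y b < suc j → Z (suc b) ≡ suc (Y b)
    shifted-arc b 1<b b<Yb Yb<1+j = begin
      Z (suc b)  ≡⟨ cong Z (sym (σ⁻¹ᶠ-≤ 1≤b (≤-pred (<-trans b<Yb Yb<1+j)))) ⟩
      Z (τ b)    ≡⟨ sym (τ∘Y b) ⟩
      τ (Y b)    ≡⟨ σ⁻¹ᶠ-≤ (≤-trans 1≤b (<⇒≤ b<Yb)) (≤-pred Yb<1+j) ⟩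
      suc (Y b)  ∎
      where 1≤b = <⇒≤ 1<b

    -- Such an arc is the image of the arc (b + 1, Y b + 1) of Z, which lies inside (3, Z 3).
    no-arc-inside-1,1+j : ∀ b → 1 < b → b < Y b → Y b < suc j → ⊥
    no-arc-inside-1,1+j b 1<b b<Yb Yb<1+j =
      [ (λ 3<1+b → nonnesting 3 (suc b) (s≤s z≤n) 3<1+b (≤-trans (s≤s (≤-pred (<-trans b<Yb Yb<1+j))) j<n)
                     (subst (suc b <_) (sym Z[1+b]≡1+Yb) (s≤s b<Yb)) Z[1+b]<Z3)
      , (λ 3≡1+b → <⇒≢ Z[1+b]<Z3 (cong Z (sym 3≡1+b)))
      ]′ (m≤n⇒m<n∨m≡n (s≤s 1<b))
      where
      Z[1+b]≡1+Yb = shifted-arc b 1<b b<Yb Yb<1+j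
      Z[1+b]<Z3 : Z (suc b) < Z 3
      Z[1+b]<Z3 = subst (_< Z 3) (sym Z[1+b]≡1+Yb) (≤-trans (s≤s Yb<1+j) 2+j≤Z3)

    νᶠ-nonnesting : IsNonnestingInvolution n Y
    νᶠ-nonnesting = record { isFPFInvolution = Y-inv ; nonnesting = Y-nonnesting }
      where
      Y-nonnesting : ∀ a b → 1 ≤ a → a < b → b ≤ n → b < Y b → Y b < Y a → ⊥
      Y-nonnesting a b 1≤a a<b b≤n b<Yb Yb<Ya with a ≟ 1 | a ≟ suc j | b ≟ suc j
      ... | yes refl | _ | _ = no-arc-inside-1,1+j b a<b b<Yb (subst (Y b <_) νᶠ-1 Yb<Ya)
      ... | no _ | yes refl | _ = <⇒≱ (<-trans b<Yb (subst (Y b <_) νᶠ-1+j Yb<Ya)) (≤-trans 1≤a (<⇒≤ a<b))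
      ... | no _ | no _ | yes refl = <⇒≱ (subst (suc j <_) νᶠ-1+j b<Yb) (s≤s z≤n)
      ... | no a≢1 | no a≢1+j | no b≢1+j =
        nonnesting (τ a) (τ b) (proj₁ (σ⁻¹ᶠ-range j j<n 1≤a a≤n))
          (σ⁻¹ᶠ-<-preserving j 1≤a a<b a≢1+j b≢1+j) (proj₂ (σ⁻¹ᶠ-range j j<n 1≤b b≤n))
          (subst (τ b <_) (τ∘Y b) (σ⁻¹ᶠ-<-preserving j 1≤b b<Yb b≢1+j Yb≢1+j))
          (subst₂ _<_ (τ∘Y b) (τ∘Y a) (σ⁻¹ᶠ-<-preserving j (Y-lower b 1≤b b≤n) Yb<Ya Yb≢1+j Ya≢1+j))
        where
        1≤b = ≤-trans 1≤a (<⇒≤ a<b)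
        a≤n = ≤-trans (<⇒≤ a<b) b≤n
        Yb≢1+j : Y b ≢ suc j
        Yb≢1+j Yb≡1+j =
          <⇒≢ (≤-<-trans 1≤a a<b) (sym (trans (sym (Y-involutive b 1≤b b≤n)) (trans (cong Y Yb≡1+j) νᶠ-1+j)))
        Ya≢1+j : Y a ≢ suc j
        Ya≢1+j Ya≡1+j = a≢1 (trans (sym (Y-involutive a 1≤a a≤n)) (trans (cong Y Ya≡1+j) νᶠ-1+j))

ν-nonnesting : ∀ {n z j} → NonnestingPerm n z → app z 1 ≡ 2 → 3 ≤ n → 1 ≤ j → 2 + j ≤ app z 3 →
               NonnestingPerm n (ν n j z)
ν-nonnesting {n} {z} {suc j} (z-nn , _) z1≡2 3≤n 1≤j 2+j≤z3 =
  IsNonnestingInvolution-cong (app-ν j (<⇒≤ (≤-trans 2+j≤z3 Z3≤n)) isFPFInvolution) (νᶠ-nonnesting 1≤j 2+j≤z3) ,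
  comp-fixesAbove _ _ _
  where
  open IsNonnestingInvolution z-nn
  open WithArc12 z-nn z1≡2 3≤n

ν-ascent : ∀ {n z} t → IsNonnestingInvolution n (app z) → app z 1 ≡ 2 → 3 ≤ n → 4 + t ≤ app z 3 →
           app (ν n (2 + t) z) (suc t) < app (ν n (2 + t) z) (2 + t)
ν-ascent {n} {z} t z-nn z1≡2 3≤n 4+t≤z3 =
  subst₂ _<_ (sym (app-νz (suc t) (s≤s z≤n) (≤-trans (n≤1+n _) 2+t≤n))) (sym (app-νz (2 + t) (s≤s z≤n) 2+t≤n))
    (νᶠ-ascent t 4+t≤z3)
  where
  open WithArc12 z-nn z1≡2 3≤n
  2+t≤n = ≤-trans (m≤n+m (2 + t) 2) (≤-trans 4+t≤z3 Z3≤n)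
  app-νz = app-ν (suc t) (<⇒≤ (≤-trans 4+t≤z3 Z3≤n)) (IsNonnestingInvolution.isFPFInvolution z-nn)

≤∸2⇒2+≤ : ∀ {j a} → 1 ≤ j → j ≤ a ∸ 1 ∸ 1 → 2 + j ≤ a
≤∸2⇒2+≤ {a = zero}        (s≤s _) ()
≤∸2⇒2+≤ {a = suc zero}    (s≤s _) ()
≤∸2⇒2+≤ {a = suc (suc a)} _       j≤a = s≤s (s≤s j≤a)

D-step : ∀ m → (∀ {y} → y ∈ D (suc m) → NonnestingPerm (suc m) y) →
         ∀ {x} → x ∈ D (3 + m) → NonnestingPerm (3 + m) x
D-step m D[1+m]-nonnesting x∈D
  with z , z∈ρD , x∈νz ← find (∈-concatMap⁻ _ {xs = map (ρ (3 + m)) (D (suc m))} x∈D)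
  with y , y∈D , refl ← ∈-map⁻ _ z∈ρD
  with j , j∈ids , refl ← ∈-map⁻ _ x∈νz
  with u , u<kz , refl ← ∈-map⁻ _ j∈ids =
  ν-nonnesting (ρ-nonnesting y-nn) (ρ-1 y-nn) (s≤s (s≤s (s≤s z≤n))) (s≤s z≤n) (≤∸2⇒2+≤ (s≤s z≤n) (∈-upTo⁻ u<kz))
  where y-nn = D[1+m]-nonnesting y∈D

-- D^2_1 = {s₁} is ρ₂ applied to the empty permutation.
D-nonnesting : ∀ m {x} → x ∈ D m → NonnestingPerm m x
D-nonnesting 2 (here refl) = ρ-nonnesting {0} {[]} (nonnesting-0 (app []) , λ { zero () ; (suc i) _ → refl })
D-nonnesting (suc (suc (suc m))) = D-step m (D-nonnesting (suc m))

-- Inversions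

below : ℕ → ℕ → ℕ
below y x = if y <ᵇ x then 1 else 0

countBelow : ℕ → List ℕ → ℕ
countBelow x L = sum (map (λ y → below y x) L)

below-mono : ∀ {x y x′ y′} → (y < x → y′ < x′) → below y x ≤ below y′ x′
below-mono {x} {y} imp with y <ᵇ x in eq
... | false = z≤n
... | true rewrite <ᵇ-true (imp (<ᵇ⇒< y x (Equivalence.from T-≡ eq))) = ≤-refl

countBelow-map : ∀ f {x L} → All (λ y → y < x → f y < f x) L → countBelow x L ≤ countBelow (f x) (map f L)
countBelow-map f []       = z≤n
countBelow-map f (p ∷ ps) = +-mono-≤ (below-mono p) (countBelow-map f ps)

ℓ-map : ∀ f {L} → AllPairs (λ x y → y < x → f y < f x) L → ℓ L ≤ ℓ (map f L)
ℓ-map f []         = z≤n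
ℓ-map f (ps ∷ pss) = +-mono-≤ (countBelow-map f ps) (ℓ-map f pss)

applyUpTo-swap-tail : ∀ (g : ℕ → ℕ) t N →
                      applyUpTo (λ k → g (sᶠ (suc t) (suc k))) N ≡ applyUpTo (g ∘ suc ∘ sᶠ t) N
applyUpTo-swap-tail g t N = applyUpTo-cong N (λ {k} _ → cong g (sᶠ-suc t k))

countBelow-swap : ∀ x t (g : ℕ → ℕ) {N} → suc t < N →
                  countBelow x (applyUpTo (g ∘ sᶠ t) N) ≡ countBelow x (applyUpTo g N)
countBelow-swap x zero    g {suc zero}    (s<s ())
countBelow-swap x zero    g {suc (suc N)} _         = x∙yz≈y∙xz (below (g 1) x) (below (g 0) x) _
countBelow-swap x (suc t) g {suc N}       (s<s t<N) = cong (below (g 0) x +_) (begin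
  countBelow x (applyUpTo (λ k → g (sᶠ (suc t) (suc k))) N) ≡⟨ cong (countBelow x) (applyUpTo-swap-tail g t N) ⟩
  countBelow x (applyUpTo (g ∘ suc ∘ sᶠ t) N)               ≡⟨ countBelow-swap x t (g ∘ suc) t<N ⟩
  countBelow x (applyUpTo (g ∘ suc) N)                       ∎)

ℓ-swap : ∀ t (g : ℕ → ℕ) {N} → suc t < N → g t < g (suc t) →
         ℓ (applyUpTo (g ∘ sᶠ t) N) ≡ suc (ℓ (applyUpTo g N))
ℓ-swap zero g {suc zero} (s<s ()) _
ℓ-swap zero g {suc (suc N)} _ g0<g1 rewrite <ᵇ-true g0<g1 | <ᵇ-false (<⇒≯ g0<g1) =
  cong suc (x∙yz≈y∙xz (countBelow (g 1) T) (countBelow (g 0) T) (ℓ T))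
  where T = applyUpTo (g ∘ suc ∘ suc) N
ℓ-swap (suc t) g {suc N} (s<s t<N) ascent = begin
  countBelow (g 0) (applyUpTo (λ k → g (sᶠ (suc t) (suc k))) N) + ℓ (applyUpTo (λ k → g (sᶠ (suc t) (suc k))) N)
    ≡⟨ cong (λ L → countBelow (g 0) L + ℓ L) (applyUpTo-swap-tail g t N) ⟩
  countBelow (g 0) (applyUpTo (g ∘ suc ∘ sᶠ t) N) + ℓ (applyUpTo (g ∘ suc ∘ sᶠ t) N)
    ≡⟨ cong₂ _+_ (countBelow-swap (g 0) t (g ∘ suc) t<N) (ℓ-swap t (g ∘ suc) t<N ascent) ⟩
  countBelow (g 0) (applyUpTo (g ∘ suc) N) + suc (ℓ (applyUpTo (g ∘ suc) N))
    ≡⟨ +-suc _ _ ⟩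
  suc (ℓ (applyUpTo g (suc N)))
    ∎

BruhatLe⇒ℓ≤ : ∀ {n a b} → BruhatLe n a b → ℓ a ≤ ℓ b
BruhatLe⇒ℓ≤ ε                           = ≤-refl
BruhatLe⇒ℓ≤ (bstep _ _ _ ℓz≤ℓz′ ◅ steps) = ≤-trans ℓz≤ℓz′ (BruhatLe⇒ℓ≤ steps)

tabulate-app : ∀ f {n} → map f (ids n) ≡ applyUpTo (app (map f (ids n)) ∘ suc) n
tabulate-app f {n} = trans (map-ids f n) (applyUpTo-cong n (λ k<n → sym (app-map-ids f (s≤s z≤n) k<n)))

-- s_i w s_i swaps the entries at positions i, i + 1 and then relabels the values i, i + 1.
conj-s : ∀ {n} t w → suc (suc t) ≤ n →
         conj n (s n (suc t)) w ≡ map (sᶠ (suc t)) (applyUpTo (λ k → app w (suc (sᶠ t k))) n)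
conj-s {n} t w t+1<n = begin
  conj n S w                                                    ≡⟨ map-ids _ n ⟩
  applyUpTo (λ k → app S (app (comp n w (invP n S)) (suc k))) n ≡⟨ applyUpTo-cong n entry ⟩
  applyUpTo (sᶠ (suc t) ∘ h) n                                  ≡⟨ sym (map-applyUpTo h (sᶠ (suc t)) n) ⟩
  map (sᶠ (suc t)) (applyUpTo h n)                              ∎
  where
  S = s n (suc t)
  h = λ k → app w (suc (sᶠ t k))
  entry : ∀ {k} → k < n → app S (app (comp n w (invP n S)) (suc k)) ≡ sᶠ (suc t) (h k)
  entry {k} k<n = begin
    app S (app (comp n w (invP n S)) (suc k)) ≡⟨ cong (app S) (app-comp (s≤s z≤n) k<n) ⟩
    app S (app w (app (invP n S) (suc k)))    ≡⟨ cong (app S ∘ app w) (app-invP-s (s≤s z≤n) t+1<n (s≤s z≤n) k<n) ⟩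
    app S (app w (sᶠ (suc t) (suc k)))        ≡⟨ app-s (s≤s z≤n) t+1<n (app w (sᶠ (suc t) (suc k))) ⟩
    sᶠ (suc t) (app w (sᶠ (suc t) (suc k)))   ≡⟨ cong (sᶠ (suc t) ∘ app w) (sᶠ-suc t k) ⟩
    sᶠ (suc t) (h k)                          ∎

ℓ-conj-s-ascent : ∀ {n t} f → suc (suc t) ≤ n → IsFPFInvolution n (app (map f (ids n))) →
                  app (map f (ids n)) (suc t) < app (map f (ids n)) (2 + t) →
                  ℓ (map f (ids n)) < ℓ (conj n (s n (suc t)) (map f (ids n)))
ℓ-conj-s-ascent {n} {t} f t+1<n Y-inv Yi<Y[1+i] =
  subst₂ _<_ (cong ℓ (sym (tabulate-app f {n}))) (cong ℓ (sym (conj-s t w t+1<n)))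
    (≤-trans (≤-reflexive (sym (ℓ-swap t g t+1<n Yi<Y[1+i])))
             (ℓ-map (sᶠ i) (AllPairs.applyUpTo⁺₁ (g ∘ sᶠ t) n no-new-inversion)))
  where
  open IsFPFInvolution Y-inv
  w = map f (ids n)
  Y = app w
  i = suc t
  g = Y ∘ suc

  preimage : ∀ {k c} → k < n → g (sᶠ t k) ≡ c → suc k ≡ sᶠ i (Y c)
  preimage {k} {c} k<n gk′≡c = begin
    suc k                  ≡⟨ sym (sᶠ-involutive i (suc k)) ⟩
    sᶠ i (sᶠ i (suc k))    ≡⟨ cong (sᶠ i) (sᶠ-suc t k) ⟩
    sᶠ i (suc (sᶠ t k))    ≡⟨ cong (sᶠ i) (sym (involutive _ 1≤p p≤n)) ⟩
    sᶠ i (Y (g (sᶠ t k)))  ≡⟨ cong (sᶠ i ∘ Y) gk′≡c ⟩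
    sᶠ i (Y c)             ∎
    where
    p-range = subst (λ p → 1 ≤ p × p ≤ n) (sᶠ-suc t k) (sᶠ-range (s≤s z≤n) t+1<n (s≤s z≤n) k<n)
    1≤p = proj₁ p-range
    p≤n = proj₂ p-range

  -- Relabelling by s_i only removes the inversion of a pair where i + 1 precedes i; after the
  -- swap, i sits at position s_i (Y i), before i + 1 at s_i (Y (i + 1)).
  no-new-inversion : ∀ {a b} → a < b → b < n → g (sᶠ t b) < g (sᶠ t a) → sᶠ i (g (sᶠ t b)) < sᶠ i (g (sᶠ t a))
  no-new-inversion {a} {b} a<b b<n inversion = sᶠ-<-preserving inversion λ (ga′≡1+i , gb′≡i) →
    <-asym (s<s a<b) (subst₂ _<_ (sym (preimage b<n gb′≡i)) (sym (preimage (<-trans a<b b<n) ga′≡1+i)) relabelled)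
    where
    relabelled : sᶠ i (Y i) < sᶠ i (Y (suc i))
    relabelled = sᶠ-<-preserving Yi<Y[1+i] (λ (Y[1+i]≡1+i , _) → fixedPointFree (suc i) (s≤s z≤n) t+1<n Y[1+i]≡1+i)

¬InTau-ascent : ∀ {n t} f → IsFPFInvolution n (app (map f (ids n))) →
                app (map f (ids n)) (suc t) < app (map f (ids n)) (2 + t) → ¬ InTau n (suc t) (map f (ids n))
¬InTau-ascent f Y-inv ascent (_ , t+1<n , s∘w∘s≤w) =
  <⇒≱ (ℓ-conj-s-ascent f t+1<n Y-inv ascent) (BruhatLe⇒ℓ≤ s∘w∘s≤w)

mainTheorem12 : (n p : ℕ) → 4 ≤ n → n ≡ 2 * p → (z : Perm) → z ∈ map (ρ n) (D (n ∸ 2)) →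
    ((j : ℕ) → 2 ≤ j → j ≤ kz z ∸ 1 → ¬ InTau n (j ∸ 1) (ν n j z)) × (kz z ≤ p + 1)
mainTheorem12 (suc (suc (suc (suc m)))) p _ n≡2p z z∈ρD
  with x , x∈D , refl ← ∈-map⁻ _ z∈ρD = no-descent , WithArc12.Z3∸1≤p+1 z-nn z1≡2 3≤n n≡2p
  where
  x-nn = D-nonnesting (2 + m) x∈D
  z-nn = proj₁ (ρ-nonnesting x-nn)
  z1≡2 = ρ-1 x-nn
  3≤n : 3 ≤ 4 + m
  3≤n = s≤s (s≤s (s≤s z≤n))

  no-descent : (j : ℕ) → 2 ≤ j → j ≤ kz z ∸ 1 → ¬ InTau (4 + m) (j ∸ 1) (ν (4 + m) j z)
  no-descent (suc (suc t)) _ j≤kz∸1 =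
    ¬InTau-ascent _ (IsNonnestingInvolution.isFPFInvolution (proj₁ νz-nn)) (ν-ascent t z-nn z1≡2 3≤n 4+t≤z3)
    where
    4+t≤z3 = ≤∸2⇒2+≤ (s≤s z≤n) j≤kz∸1
    νz-nn = ν-nonnesting (ρ-nonnesting x-nn) z1≡2 3≤n (s≤s z≤n) 4+t≤z3
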